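{- Let $G=(V,E)$ be a finite, simple, undirected, unweighted, connected graph and let $a,b\in V$ be distinct vertices with $ab\in E$. Then $$\frac{\min(C_G(a),C_G(b))}{\max(C_G(a),C_G(b))} > \frac{1}{2},$$ where $C_G(v)=\sum_{u\in V} d_G(u,v)$.
   Context: $d_G(u,v)$ denotes the shortest-path distance between $u$ and $v$ in $G$. $C_G(v)=\sum_{u\in V}d_G(u,v)$ is the closeness centrality of $v$ (smaller means more central), and $\frac{\min(C_G(a),C_G(b))}{\max(C_G(a),C_G(b))}$ is the closeness ratio of $a$ and $b$ in $G$. -}

module Defs where

open import Level using (0ℓ)
open import Data.Nat using (ℕ; zero; suc; _⊔_; _⊓_; _≤_)
open import Data.Fin using (Fin)
open import Data.List using (List; map; allFin)
open import Data.Nat.ListAction using (sum)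
open import Data.Integer using (+_)
open import Data.Rational using (ℚ; _/_; 0ℚ)
open import Data.Product using (∃; _×_)
open import Relation.Nullary using (¬_)
open import Relation.Binary.PropositionalEquality using (_≡_)

record SimpleGraph (n : ℕ) : Set₁ where
  field
    Adj     : Fin n → Fin n → Set
    sym     : ∀ {u v} → Adj u v → Adj v u
    irrefl  : ∀ {u} → ¬ Adj u u
open SimpleGraph public

data Walk {n : ℕ} (G : SimpleGraph n) : Fin n → Fin n → ℕ → Set where
  nil  : ∀ {u} → Walk G u u zero
  cons : ∀ {u w v k} → Adj G u w → Walk G w v k → Walk G u v (suc k)

Connected : ∀ {n} → SimpleGraph n → Set
Connected G = ∀ u v → ∃ λ k → Walk G u v k

IsDistance : ∀ {n} → SimpleGraph n → Fin n → Fin n → ℕ → Set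
IsDistance G u v k = Walk G u v k × (∀ {m} → Walk G u v m → k ≤ m)

closeness : ∀ {n} → (Fin n → Fin n → ℕ) → Fin n → ℕ
closeness {n} d v = sum (map (λ u → d u v) (allFin n))

-- min(x,y)/max(x,y) as a rational (convention: 0 when max = 0, which
-- cannot occur in the theorem).
closenessRatioℕ : ℕ → ℕ → ℚ
closenessRatioℕ x y = go (x ⊓ y) (x ⊔ y)
  where
  go : ℕ → ℕ → ℚ
  go m zero    = 0ℚ
  go m (suc k) = (+ m) / suc k

closenessRatio : ∀ {n} → (Fin n → Fin n → ℕ) → Fin n → Fin n → ℚ
closenessRatio d a b = closenessRatioℕ (closeness d a) (closeness d b)

{-# OPTIONS --safe #-}
-- Moving from a to its neighbour b changes each distance d(u,·) by at most
-- one, and d(b,b) = 0 = d(b,a) - 1, so C(b) ≤ C(a) + n - 2. Every vertex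
-- other than a is at distance at least 1 from a, so C(a) ≥ n - 1. Together
-- C(b) ≤ 2 C(a) - 1 < 2 C(a), and symmetrically C(a) < 2 C(b), so the larger
-- closeness is less than twice the smaller one.
module Submission where

open import Defs
open import Data.Nat using (ℕ)
open import Data.Fin using (Fin)
open import Data.Rational using (½; _<_)
open import Relation.Nullary using (¬_)
open import Relation.Binary.PropositionalEquality using (_≡_)

open import Data.Fin using (zero; suc; punchIn)
open import Data.Fin.Properties using (punchInᵢ≢i)
open import Data.Integer as ℤ using (+<+)
import Data.Integer.Properties as ℤ
open import Data.List using (tabulate)
open import Data.List.Properties using (map-tabulate)
open import Data.Nat as ℕ using (zero; suc; _+_; _*_; _≤_; z≤n; s≤s; NonZero)
open import Data.Nat.ListAction using (sum)
open import Data.Nat.Properties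
open import Data.Product using (_,_)
open import Data.Rational using (_/_)
open import Data.Rational.Properties using (toℚᵘ-cancel-<; toℚᵘ-fromℚᵘ)
open import Data.Rational.Unnormalised as ℚᵘ using (mkℚᵘ; *<*)
import Data.Rational.Unnormalised.Properties as ℚᵘ
open import Data.Sum using (inj₁; inj₂)
open import Data.Vec.Functional using (Vector)
open import Function using (id; _∘_)
open import Relation.Binary.PropositionalEquality
  using (refl; trans; cong; subst; subst₂; _≢_; ≢-sym)
import Relation.Binary.PropositionalEquality as ≡
open import Relation.Nullary using (contradiction)

open import Algebra.Properties.CommutativeSemigroup +-commutativeSemigroup
  using (x∙yz≈y∙xz)
open import Algebra.Properties.CommutativeMonoid.Sum +-0-commutativeMonoid
  using (sum-syntax; sum-remove)
  renaming (sum to ∑)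

sum-tabulate : ∀ {n} (f : Vector ℕ n) → sum (tabulate f) ≡ ∑ f
sum-tabulate {zero}  f = refl
sum-tabulate {suc n} f = cong (f zero +_) (sum-tabulate (f ∘ suc))

∑-mono-≤ : ∀ {n} {f g : Vector ℕ n} → (∀ i → f i ≤ g i) → ∑ f ≤ ∑ g
∑-mono-≤ {zero}  f≤g = z≤n
∑-mono-≤ {suc n} f≤g = +-mono-≤ (f≤g zero) (∑-mono-≤ (f≤g ∘ suc))

∑-suc : ∀ {n} (f : Vector ℕ n) → ∑[ i < n ] suc (f i) ≡ n + ∑ f
∑-suc {zero}  f = refl
∑-suc {suc n} f = cong suc (trans (cong (f zero +_) (∑-suc (f ∘ suc))) (x∙yz≈y∙xz (f zero) n _))

∑-pos : ∀ {n} {f : Vector ℕ n} → (∀ i → 0 ℕ.< f i) → n ≤ ∑ f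
∑-pos {zero}  f>0 = z≤n
∑-pos {suc n} f>0 = +-mono-≤ (f>0 zero) (∑-pos (f>0 ∘ suc))

module _ {n} {G : SimpleGraph n} where

  adj⇒≢ : ∀ {u v} → Adj G u v → u ≢ v
  adj⇒≢ u~v refl = irrefl G u~v

  walk-snoc : ∀ {u v w k} → Walk G u v k → Adj G v w → Walk G u w (suc k)
  walk-snoc nil        v~w = cons v~w nil
  walk-snoc (cons e p) v~w = cons e (walk-snoc p v~w)

  walk-length-zero⇒≡ : ∀ {u v} → Walk G u v 0 → u ≡ v
  walk-length-zero⇒≡ nil = refl

  isDistance-self : ∀ {u k} → IsDistance G u u k → k ≡ 0
  isDistance-self (_ , minimal) = n≤0⇒n≡0 (minimal nil)

  isDistance-pos : ∀ {u v k} → u ≢ v → IsDistance G u v k → 0 ℕ.< k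
  isDistance-pos {k = zero}  u≢v (p , _) = contradiction (walk-length-zero⇒≡ p) u≢v
  isDistance-pos {k = suc k} u≢v _       = s≤s z≤n

  isDistance-adj : ∀ {u v w k l} → Adj G v w →
                   IsDistance G u v k → IsDistance G u w l → l ≤ suc k
  isDistance-adj v~w (p , _) (_ , minimal) = minimal (walk-snoc p v~w)

IsDistanceFunction : ∀ {n} → SimpleGraph n → (Fin n → Fin n → ℕ) → Set
IsDistanceFunction G d = ∀ u v → IsDistance G u v (d u v)

closeness≡∑ : ∀ {n} (d : Fin n → Fin n → ℕ) v → closeness d v ≡ ∑[ u < n ] d u v
closeness≡∑ d v = trans (cong sum (map-tabulate id (λ u → d u v))) (sum-tabulate (λ u → d u v))

module _ {m} {G : SimpleGraph (suc m)} {d} (isDist : IsDistanceFunction G d) where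

  closeness-removeAt : ∀ v i → closeness d v ≡ d i v + ∑[ u < m ] d (punchIn i u) v
  closeness-removeAt v i = trans (closeness≡∑ d v) (sum-remove (λ u → d u v))

  closeness-removeSelf : ∀ v → closeness d v ≡ ∑[ u < m ] d (punchIn v u) v
  closeness-removeSelf v = trans (closeness-removeAt v v)
    (cong (_+ ∑[ u < m ] d (punchIn v u) v) (isDistance-self (isDist v v)))

  m≤closeness : ∀ a → m ≤ closeness d a
  m≤closeness a = begin
    m                             ≤⟨ ∑-pos {m} (λ u → isDistance-pos (punchInᵢ≢i a u) (isDist _ a)) ⟩
    ∑[ u < m ] d (punchIn a u) a  ≡⟨ closeness-removeSelf a ⟨
    closeness d a                 ∎
    where open ≤-Reasoning

  adjacent⇒closeness<closeness+m : ∀ {a b} → Adj G a b → closeness d b ℕ.< closeness d a + m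
  adjacent⇒closeness<closeness+m {a} {b} a~b = begin-strict
    closeness d b                               ≡⟨ closeness-removeSelf b ⟩
    ∑[ u < m ] d (punchIn b u) b                ≤⟨ ∑-mono-≤ {m} (λ u → isDistance-adj a~b (isDist _ a) (isDist _ b)) ⟩
    ∑[ u < m ] suc (d (punchIn b u) a)          ≡⟨ ∑-suc (λ u → d (punchIn b u) a) ⟩
    m + ∑[ u < m ] d (punchIn b u) a            <⟨ +-monoʳ-< m (+-monoˡ-< _ d[b,a]>0) ⟩
    m + (d b a + ∑[ u < m ] d (punchIn b u) a)  ≡⟨ cong (m +_) (closeness-removeAt a b) ⟨
    m + closeness d a                           ≡⟨ +-comm m _ ⟩
    closeness d a + m                           ∎
    where
    open ≤-Reasoning
    d[b,a]>0 : 0 ℕ.< d b a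
    d[b,a]>0 = isDistance-pos (≢-sym (adj⇒≢ {G = G} a~b)) (isDist b a)

adjacent⇒closeness<2*closeness : ∀ {n} {G : SimpleGraph n} {d} → IsDistanceFunction G d →
                                 ∀ {a b} → Adj G a b → closeness d b ℕ.< 2 * closeness d a
adjacent⇒closeness<2*closeness {zero}          _      {a = ()}
adjacent⇒closeness<2*closeness {suc m} {d = d} isDist {a} {b} a~b = begin-strict
  closeness d b                   <⟨ adjacent⇒closeness<closeness+m isDist a~b ⟩
  closeness d a + m               ≤⟨ +-monoʳ-≤ (closeness d a) (m≤closeness isDist a) ⟩
  closeness d a + closeness d a   ≡⟨ cong (closeness d a +_) (+-identityʳ _) ⟨
  2 * closeness d a               ∎
  where open ≤-Reasoning

½<m/n : ∀ m n .{{_ : NonZero n}} → n ℕ.< 2 * m → ½ < ℤ.+ m / n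
-- _/_ normalises by the gcd, so compare the unnormalised fractions.
½<m/n m (suc k) n<2m = toℚᵘ-cancel-<
  (ℚᵘ.<-respʳ-≃ (ℚᵘ.≃-sym (toℚᵘ-fromℚᵘ (mkℚᵘ (ℤ.+ m) k)))
  (ℚᵘ.<-respˡ-≃ (ℚᵘ.≃-sym (toℚᵘ-fromℚᵘ (mkℚᵘ (ℤ.+ 1) 1)))
  (*<* (subst₂ ℤ._<_ (≡.sym (ℤ.*-identityˡ (ℤ.+ suc k)))
                     (trans (ℤ.pos-* 2 m) (ℤ.*-comm (ℤ.+ 2) (ℤ.+ m)))
                     (+<+ n<2m)))))

closenessRatioℕ-comm : ∀ x y → closenessRatioℕ x y ≡ closenessRatioℕ y x
closenessRatioℕ-comm x y rewrite ⊓-comm x y | ⊔-comm x y = refl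

½<closenessRatioℕ-≤ : ∀ {x y} → x ≤ y → y ℕ.< 2 * x → ½ < closenessRatioℕ x y
½<closenessRatioℕ-≤ {y = zero}  z≤n ()
½<closenessRatioℕ-≤ {x} {suc k} x≤y y<2x rewrite m≤n⇒m⊓n≡m x≤y | m≤n⇒m⊔n≡n x≤y =
  ½<m/n x (suc k) y<2x

½<closenessRatioℕ : ∀ x y → y ℕ.< 2 * x → x ℕ.< 2 * y → ½ < closenessRatioℕ x y
½<closenessRatioℕ x y y<2x x<2y with ≤-total x y
... | inj₁ x≤y = ½<closenessRatioℕ-≤ x≤y y<2x
... | inj₂ y≤x = subst (½ <_) (closenessRatioℕ-comm y x) (½<closenessRatioℕ-≤ y≤x x<2y)

mainTheorem1 : ∀ {n : ℕ} (G : SimpleGraph n) → Connected G →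
    (d : Fin n → Fin n → ℕ) → (∀ u v → IsDistance G u v (d u v)) →
    (a b : Fin n) → ¬ (a ≡ b) → Adj G a b →
    ½ < closenessRatio d a b
mainTheorem1 G _ d isDist a b _ a~b =
  ½<closenessRatioℕ (closeness d a) (closeness d b)
    (adjacent⇒closeness<2*closeness isDist a~b)
    (adjacent⇒closeness<2*closeness isDist (SimpleGraph.sym G a~b))
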